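{- Let $T$ be a finite forest, let $v$ be a stem in $T$, let $R$ be the set of leaf neighbors of $v$, and let $r=|R|\ge1$. If $r+1$ is not a triangular number, then $\mathring{s}(T)=\mathring{s}(T-R-v)+\mathring{s}(K_{1,r})$.
   Context: Slow-coloring game on a finite graph $G$: in each round Lister marks a nonempty set $M$ of currently uncolored vertices, scoring $|M|$ points; Painter then colors a subset of $M$ independent in $G$. The game ends when all vertices are colored. Painter minimizes and Lister maximizes the total score; the sum-color cost $\mathring{s}(G)$ is the value of the game (with $\mathring{s}$ of the graph with no vertices equal to $0$). $K_{1,r}$ is the star with $r$ leaves. A leaf is a vertex of degree 1; a stem in a forest is a vertex having a leaf neighbor and at most one non-leaf neighbor. Triangular numbers are $t_k=\binom{k+1}{2}$ for integers $k\ge1$. -}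

module Defs where

open import Data.Nat using (ℕ; zero; suc; _+_; _⊔_; _⊓_)
open import Data.Nat.Combinatorics using (_C_)
open import Data.Bool using (Bool; true; false; _∧_; _∨_; not; if_then_else_)
open import Data.Fin using (Fin; zero; suc; inject₁; fromℕ; _≟_)
open import Data.Fin.Subset using (Subset; ∣_∣; _─_; ⊤; ⊥)
open import Data.Vec using (Vec; []; _∷_; lookup)
open import Data.List using (List; []; _∷_; [_]; map; _++_; foldr; filter; allFin)
open import Data.Product using (Σ; ∃; _×_; _,_)
open import Relation.Binary.PropositionalEquality using (_≡_)
open import Relation.Nullary using (¬_)
open import Function.Definitions using (Injective)
open import Relation.Nullary.Decidable using (⌊_⌋)

record Graph : Set where
  field
    n      : ℕ
    adj    : Fin n → Fin n → Bool
    sym    : ∀ u w → adj u w ≡ adj w u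
    irrefl : ∀ u → adj u u ≡ false
open Graph public

record Cycle (G : Graph) : Set where
  field
    k     : ℕ
    c     : Fin (suc (suc (suc k))) → Fin (n G)
    inj   : Injective _≡_ _≡_ c
    step  : ∀ (i : Fin (suc (suc k))) → adj G (c (inject₁ i)) (c (suc i)) ≡ true
    close : adj G (c (fromℕ (suc (suc k)))) (c zero) ≡ true

Forest : Graph → Set
Forest G = ¬ Cycle G

degree : (G : Graph) → Fin (n G) → ℕ
degree G u = Data.List.length (filter (λ w → adj G u w Data.Bool.≟ true) (allFin (n G)))

isLeaf : (G : Graph) → Fin (n G) → Bool
isLeaf G u = ⌊ degree G u Data.Nat.≟ 1 ⌋

leafNbrs : (G : Graph) → Fin (n G) → Subset (n G)
leafNbrs G v = Data.Vec.tabulate (λ w → adj G v w ∧ isLeaf G w)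

nonLeafNbrs : (G : Graph) → Fin (n G) → Subset (n G)
nonLeafNbrs G v = Data.Vec.tabulate (λ w → adj G v w ∧ not (isLeaf G w))

IsStem : (G : Graph) → Fin (n G) → Set
IsStem G v = (1 Data.Nat.≤ ∣ leafNbrs G v ∣) × (∣ nonLeafNbrs G v ∣ Data.Nat.≤ 1)

Triangular : ℕ → Set
Triangular m = ∃ λ k → (1 Data.Nat.≤ k) × (m ≡ (suc k) C 2)

allB : ∀ {A : Set} → (A → Bool) → List A → Bool
allB p = foldr (λ x b → p x ∧ b) true

anyB : ∀ {A : Set} → (A → Bool) → List A → Bool
anyB p = foldr (λ x b → p x ∨ b) false

bfilter : ∀ {A : Set} → (A → Bool) → List A → List A
bfilter p []       = []
bfilter p (x ∷ xs) = if p x then x ∷ bfilter p xs else bfilter p xs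

allSubsets : ∀ m → List (Subset m)
allSubsets zero    = [ [] ]
allSubsets (suc m) = map (true ∷_) (allSubsets m) ++ map (false ∷_) (allSubsets m)

member : ∀ {m} → Fin m → Subset m → Bool
member i S = lookup S i

subsetB : ∀ {m} → Subset m → Subset m → Bool
subsetB {m} A B = allB (λ i → not (member i A) ∨ member i B) (allFin m)

nonemptyB : ∀ {m} → Subset m → Bool
nonemptyB {m} A = anyB (λ i → member i A) (allFin m)

independentB : (G : Graph) → Subset (n G) → Bool
independentB G X =
  allB (λ u → allB (λ w → not (member u X ∧ member w X ∧ adj G u w)) (allFin (n G))) (allFin (n G))

-- nonempty subsets of U (Lister's possible marked sets)
markings : ∀ {m} → Subset m → List (Subset m)
markings {m} U = bfilter (λ M → subsetB M U ∧ nonemptyB M) (allSubsets m)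

-- nonempty independent subsets of M (Painter's possible responses)
responses : (G : Graph) → Subset (n G) → List (Subset (n G))
responses G M =
  bfilter (λ X → subsetB X M ∧ nonemptyB X ∧ independentB G X) (allSubsets (n G))

maxL : List ℕ → ℕ
maxL = foldr _⊔_ 0

minL : List ℕ → ℕ
minL []       = 0
minL (x ∷ xs) = foldr _⊓_ x xs

-- value of the game on the induced subgraph G[U] (U = uncoloured vertices),
-- computed by the minimax recursion with a fuel parameter
gameValue : (G : Graph) → ℕ → Subset (n G) → ℕ
gameValue G zero    U = 0
gameValue G (suc f) U =
  maxL (map (λ M → ∣ M ∣ + minL (map (λ X → gameValue G f (U ─ X)) (responses G M)))
            (markings U))

-- sum-color cost s̊(G[W]) of the subgraph of G induced by W;
-- fuel n suffices since each round colours at least one vertex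
inducedCost : (G : Graph) → Subset (n G) → ℕ
inducedCost G W = gameValue G (n G) W

sumColorCost : Graph → ℕ
sumColorCost G = inducedCost G ⊤

starAdj : ∀ r → Fin (suc r) → Fin (suc r) → Bool
starAdj r zero    zero    = false
starAdj r zero    (suc _) = true
starAdj r (suc _) zero    = true
starAdj r (suc _) (suc _) = false

starSym : ∀ r u w → starAdj r u w ≡ starAdj r w u
starSym r zero    zero    = Relation.Binary.PropositionalEquality.refl
starSym r zero    (suc _) = Relation.Binary.PropositionalEquality.refl
starSym r (suc _) zero    = Relation.Binary.PropositionalEquality.refl
starSym r (suc _) (suc _) = Relation.Binary.PropositionalEquality.refl

starIrrefl : ∀ r u → starAdj r u u ≡ false
starIrrefl r zero    = Relation.Binary.PropositionalEquality.refl
starIrrefl r (suc _) = Relation.Binary.PropositionalEquality.refl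

K1 : ℕ → Graph
K1 r = record { n = suc r ; adj = starAdj r ; sym = starSym r ; irrefl = starIrrefl r }

removeStemLeaves : (G : Graph) → Fin (n G) → Subset (n G)
removeStemLeaves G v = (⊤ ─ leafNbrs G v) Data.Fin.Subset.- v

module Submission where

-- Let triRoot x be the largest k with t_k ≤ x and starValue j = j + 1 +
-- triRoot j.  The proof combines three bounds on the game value.
--  * StarLower: marking the centre with triRoot j of the j leaves, and
--    repeating, Lister forces starValue j on a star with j leaves.
--  * StemUpper: Painter answers optimally on the rest H of the graph and
--    greedily on the star at v.  The only interaction is through the one
--    non-leaf neighbour w of v, worth one extra leaf to Lister:
--    value(U) ≤ value(U ∩ H) + starCost, where starCost uses triRoot (j+1)
--    instead of triRoot j while w is uncoloured.  Without the triangular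
--    case the two agree.
--  * Superadditivity over disjoint vertex sets (Lister plays the two games
--    one after the other).

open import Defs hiding (sym)
open import Data.Nat using (ℕ; zero; suc; _≤_; _<_; _+_; _∸_; z≤n; s≤s; _⊓_; _≟_; _≤?_; _<?_)
open import Data.Nat.Properties
open import Data.Nat.Tactic.RingSolver using (solve-∀)
open import Data.Nat.Combinatorics using (_C_; nC1≡n; nCk+nC[k+1]≡[n+1]C[k+1])
open import Data.Bool using (Bool; true; false; _∧_; _∨_; not) renaming (_≟_ to _≟ᵇ_)
open import Data.Bool using (f≤t; b≤b) renaming (_≤_ to _≤ᵇ_)
open import Data.Bool.Properties using (∧-conicalˡ; ∧-conicalʳ)
open import Data.List using (List; []; _∷_; map; foldr; allFin; length; filter)
open import Data.List.Membership.Propositional using () renaming (_∈_ to _∈ˡ_)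
open import Data.List.Membership.Propositional.Properties
  using (∈-map⁺; ∈-map⁻; ∈-++⁺ˡ; ∈-++⁺ʳ; ∈-allFin; ∈-filter⁺; ∈-length)
open import Data.List.Relation.Unary.Any using (here; there)
open import Data.Fin using (Fin; zero; suc) renaming (_≟_ to _≟ᶠ_)
open import Data.Fin.Subset
  using (Subset; inside; outside; ∣_∣; _─_; _∩_; _∪_; ⁅_⁆; ⊤; ⊥; _∈_; _∉_; _⊆_; Nonempty)
open import Data.Fin.Subset.Properties
  using (∣⊥∣≡0; ∣⊤∣≡n; ∣p∣≤n; ⊆⊤; ∩-identityˡ; x∈p∩q⁺; x∈p∩q⁻; x∈p∪q⁺; x∈p∪q⁻; x∈⁅x⁆; x∈⁅y⁆⇒x≡y; ∣⁅x⁆∣≡1; ∉⊥; ∈⊤;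
         p─q⊆p; p─⊥≡p; x∈p∧x∉q⇒x∈p─q; nonempty?; Empty-unique; ⊥⊆; p⊆q⇒∣p∣≤∣q∣; ⊆-antisym; _∈?_)
open import Data.Vec using ([]; _∷_; here; there)
open import Data.Vec.Properties using (lookup⇒[]=; []=⇒lookup; lookup∘tabulate)
open import Data.Product using (∃; _×_; _,_; proj₁; proj₂)
open import Data.Sum using (_⊎_; inj₁; inj₂; [_,_]′)
open import Data.Empty using (⊥-elim)
open import Function using (_∘_)
open import Relation.Binary.PropositionalEquality
  using (_≡_; _≢_; refl; sym; trans; cong; cong₂; subst; subst₂; module ≡-Reasoning)
open import Relation.Nullary using (¬_; yes; no)

private variable
  m : ℕ
  i x y : Fin m
  p q : Subset m

member⇒∈ : member i p ≡ true → i ∈ p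
member⇒∈ {i = i} {p = p} = lookup⇒[]= i p

∈⇒member : i ∈ p → member i p ≡ true
∈⇒member = []=⇒lookup

∉⇒member : i ∉ p → member i p ≡ false
∉⇒member {i = i} {p = p} i∉p with member i p in e
... | true  = ⊥-elim (i∉p (member⇒∈ e))
... | false = refl

x∈p─q⇒x∉q : ∀ (p q : Subset m) → x ∈ p ─ q → x ∉ q
x∈p─q⇒x∉q (_ ∷ p) (outside ∷ q) here        ()
x∈p─q⇒x∉q (_ ∷ p) (outside ∷ q) (there x∈) (there x∈q) = x∈p─q⇒x∉q p q x∈ x∈q
x∈p─q⇒x∉q (_ ∷ p) (inside  ∷ q) (there x∈) (there x∈q) = x∈p─q⇒x∉q p q x∈ x∈q

x∈p─q⁻ : ∀ (p q : Subset m) → x ∈ p ─ q → x ∈ p × x ∉ q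
x∈p─q⁻ p q x∈ = p─q⊆p p q x∈ , x∈p─q⇒x∉q p q x∈

─-monoˡ : ∀ (p q r : Subset m) → p ⊆ q → p ─ r ⊆ q ─ r
─-monoˡ p q r p⊆q x∈ = let x∈p , x∉r = x∈p─q⁻ p r x∈ in x∈p∧x∉q⇒x∈p─q (p⊆q x∈p) x∉r

Disjoint : Subset m → Subset m → Set
Disjoint p q = ∀ {x} → x ∈ p → x ∉ q

x∈p⇒⁅x⁆⊆p : x ∈ p → ⁅ x ⁆ ⊆ p
x∈p⇒⁅x⁆⊆p {x = x} x∈p y∈ = subst (_∈ _) (sym (x∈⁅y⁆⇒x≡y x y∈)) x∈p

∣p∣≡∣p∩q∣+∣p─q∣ : ∀ (p q : Subset m) → ∣ p ∣ ≡ ∣ p ∩ q ∣ + ∣ p ─ q ∣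
∣p∣≡∣p∩q∣+∣p─q∣ []            []            = refl
∣p∣≡∣p∩q∣+∣p─q∣ (inside  ∷ p) (inside  ∷ q) = cong suc (∣p∣≡∣p∩q∣+∣p─q∣ p q)
∣p∣≡∣p∩q∣+∣p─q∣ (inside  ∷ p) (outside ∷ q) =
  trans (cong suc (∣p∣≡∣p∩q∣+∣p─q∣ p q)) (sym (+-suc _ _))
∣p∣≡∣p∩q∣+∣p─q∣ (outside ∷ p) (inside  ∷ q) = ∣p∣≡∣p∩q∣+∣p─q∣ p q
∣p∣≡∣p∩q∣+∣p─q∣ (outside ∷ p) (outside ∷ q) = ∣p∣≡∣p∩q∣+∣p─q∣ p q

∣p∣≡∣q∣+∣p─q∣ : ∀ (p q : Subset m) → q ⊆ p → ∣ p ∣ ≡ ∣ q ∣ + ∣ p ─ q ∣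
∣p∣≡∣q∣+∣p─q∣ p q q⊆p = trans (∣p∣≡∣p∩q∣+∣p─q∣ p q) (cong (λ s → ∣ s ∣ + ∣ p ─ q ∣) p∩q≡q)
  where
  p∩q≡q : p ∩ q ≡ q
  p∩q≡q = ⊆-antisym (proj₂ ∘ x∈p∩q⁻ p q) (λ x∈q → x∈p∩q⁺ (q⊆p x∈q , x∈q))

nonempty⇒∣p∣≥1 : ∀ (p : Subset m) → Nonempty p → 1 ≤ ∣ p ∣
nonempty⇒∣p∣≥1 p (x , x∈p) = subst (_≤ ∣ p ∣) (∣⁅x⁆∣≡1 x) (p⊆q⇒∣p∣≤∣q∣ (x∈p⇒⁅x⁆⊆p x∈p))

∣p∣≥1⇒nonempty : ∀ (p : Subset m) → 1 ≤ ∣ p ∣ → Nonempty p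
∣p∣≥1⇒nonempty (inside  ∷ p) _ = zero , here
∣p∣≥1⇒nonempty (outside ∷ p) h with ∣p∣≥1⇒nonempty p h
... | x , x∈p = suc x , there x∈p

-- Removing a nonempty part strictly decreases the size; this makes every
-- round of the game colour something.
∣p─q∣<∣p∣ : ∀ (p q : Subset m) → q ⊆ p → Nonempty q → ∣ p ─ q ∣ < ∣ p ∣
∣p─q∣<∣p∣ p q q⊆p ne = begin-strict
  ∣ p ─ q ∣         <⟨ m<n+m _ (nonempty⇒∣p∣≥1 q ne) ⟩
  ∣ q ∣ + ∣ p ─ q ∣ ≡⟨ sym (∣p∣≡∣q∣+∣p─q∣ p q q⊆p) ⟩
  ∣ p ∣             ∎
  where open ≤-Reasoning

member-mono : ∀ {p q : Subset m} x → p ⊆ q → member x p ≤ᵇ member x q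
member-mono {p = p} {q} x p⊆q with member x p in e
... | false = false≤ (member x q)
  where
  false≤ : ∀ b → false ≤ᵇ b
  false≤ false = b≤b
  false≤ true  = f≤t
... | true  = subst (true ≤ᵇ_) (sym (∈⇒member (p⊆q (member⇒∈ e)))) b≤b

∣p∩⁅x⁆∣≡1 : ∀ (p : Subset m) → x ∈ p → ∣ p ∩ ⁅ x ⁆ ∣ ≡ 1
∣p∩⁅x⁆∣≡1 {x = x} p x∈p = trans (cong ∣_∣ (⊆-antisym (proj₂ ∘ x∈p∩q⁻ p ⁅ x ⁆)
  (λ y∈x → x∈p∩q⁺ (subst (_∈ p) (sym (x∈⁅y⁆⇒x≡y x y∈x)) x∈p , y∈x)))) (∣⁅x⁆∣≡1 x)

∣p∩⁅x⁆∣≡0 : ∀ (p : Subset m) → x ∉ p → ∣ p ∩ ⁅ x ⁆ ∣ ≡ 0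
∣p∩⁅x⁆∣≡0 {m} {x} p x∉p = n≤0⇒n≡0 (subst (∣ p ∩ ⁅ x ⁆ ∣ ≤_) (∣⊥∣≡0 m) (p⊆q⇒∣p∣≤∣q∣ none))
  where
  none : p ∩ ⁅ x ⁆ ⊆ ⊥
  none y∈ = let y∈p , y∈x = x∈p∩q⁻ p ⁅ x ⁆ y∈ in
    ⊥-elim (x∉p (subst (_∈ p) (x∈⁅y⁆⇒x≡y x y∈x) y∈p))

∣p∪⁅x⁆∣≡1+∣p∣ : ∀ (p : Subset m) → x ∉ p → ∣ p ∪ ⁅ x ⁆ ∣ ≡ suc ∣ p ∣
∣p∪⁅x⁆∣≡1+∣p∣ {x = x} p x∉p = begin
  ∣ p ∪ ⁅ x ⁆ ∣                          ≡⟨ ∣p∣≡∣q∣+∣p─q∣ (p ∪ ⁅ x ⁆) ⁅ x ⁆ (x∈p⇒⁅x⁆⊆p (x∈p∪q⁺ (inj₂ (x∈⁅x⁆ x)))) ⟩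
  ∣ ⁅ x ⁆ ∣ + ∣ (p ∪ ⁅ x ⁆) ─ ⁅ x ⁆ ∣    ≡⟨ cong₂ _+_ (∣⁅x⁆∣≡1 x) (cong ∣_∣ removeAgain) ⟩
  suc ∣ p ∣                              ∎
  where
  open ≡-Reasoning
  removeAgain : (p ∪ ⁅ x ⁆) ─ ⁅ x ⁆ ≡ p
  removeAgain = ⊆-antisym
    (λ y∈ → let y∈p∪x , y∉x = x∈p─q⁻ (p ∪ ⁅ x ⁆) ⁅ x ⁆ y∈ in
      [ (λ y∈p → y∈p) , (λ y∈x → ⊥-elim (y∉x y∈x)) ]′ (x∈p∪q⁻ p ⁅ x ⁆ y∈p∪x))
    (λ {y} y∈p → x∈p∧x∉q⇒x∈p─q (x∈p∪q⁺ (inj₁ y∈p))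
      (λ y∈x → x∉p (subst (_∈ p) (x∈⁅y⁆⇒x≡y x y∈x) y∈p)))

disjoint-size : ∀ (p q r : Subset m) → p ⊆ r → q ⊆ r → Disjoint p q → ∣ p ∣ + ∣ q ∣ ≤ ∣ r ∣
disjoint-size p q r p⊆r q⊆r p∩q=∅ = begin
  ∣ p ∣ + ∣ q ∣     ≤⟨ +-monoʳ-≤ ∣ p ∣ (p⊆q⇒∣p∣≤∣q∣ q⊆r─p) ⟩
  ∣ p ∣ + ∣ r ─ p ∣ ≡⟨ sym (∣p∣≡∣q∣+∣p─q∣ r p p⊆r) ⟩
  ∣ r ∣             ∎
  where
  open ≤-Reasoning
  q⊆r─p : q ⊆ r ─ p
  q⊆r─p x∈q = x∈p∧x∉q⇒x∈p─q (q⊆r x∈q) (λ x∈p → p∩q=∅ x∈p x∈q)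

∣p∣≥2 : ∀ (p : Subset m) → x ≢ y → x ∈ p → y ∈ p → 2 ≤ ∣ p ∣
∣p∣≥2 {x = x} {y = y} p x≢y x∈p y∈p = begin
  2                            ≤⟨ s≤s (nonempty⇒∣p∣≥1 (p ─ ⁅ x ⁆) (y , y∈p─x)) ⟩
  1 + ∣ p ─ ⁅ x ⁆ ∣            ≡⟨ cong (_+ ∣ p ─ ⁅ x ⁆ ∣) (sym (∣⁅x⁆∣≡1 x)) ⟩
  ∣ ⁅ x ⁆ ∣ + ∣ p ─ ⁅ x ⁆ ∣    ≡⟨ sym (∣p∣≡∣q∣+∣p─q∣ p ⁅ x ⁆ (x∈p⇒⁅x⁆⊆p x∈p)) ⟩
  ∣ p ∣                        ∎
  where
  open ≤-Reasoning
  y∈p─x : y ∈ p ─ ⁅ x ⁆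
  y∈p─x = x∈p∧x∉q⇒x∈p─q y∈p (λ y∈x → x≢y (sym (x∈⁅y⁆⇒x≡y x y∈x)))

subsetOfSize : ∀ (p : Subset m) k → k ≤ ∣ p ∣ → ∃ λ q → q ⊆ p × ∣ q ∣ ≡ k
subsetOfSize {m} p zero _ = ⊥ , ⊥⊆ , ∣⊥∣≡0 m
subsetOfSize (inside ∷ p) (suc k) (s≤s k≤) with subsetOfSize p k k≤
... | q , q⊆p , ∣q∣ = inside ∷ q , grow , cong suc ∣q∣
  where
  grow : inside ∷ q ⊆ inside ∷ p
  grow here        = here
  grow (there x∈q) = there (q⊆p x∈q)
subsetOfSize (outside ∷ p) (suc k) k≤ with subsetOfSize p (suc k) k≤
... | q , q⊆p , ∣q∣ = outside ∷ q , grow , ∣q∣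
  where
  grow : outside ∷ q ⊆ outside ∷ p
  grow (there x∈q) = there (q⊆p x∈q)

maxL-ub : ∀ {x} (xs : List ℕ) → x ∈ˡ xs → x ≤ maxL xs
maxL-ub (y ∷ ys) (here refl) = m≤m⊔n y (maxL ys)
maxL-ub (y ∷ ys) (there x∈)  = ≤-trans (maxL-ub ys x∈) (m≤n⊔m y (maxL ys))

-- A least-upper-bound property of `maxL`, with an offset c added to every
-- entry (needed for superadditivity, where a second game value rides along).
maxL-lub+ : ∀ (xs : List ℕ) c K → (∀ x → x ∈ˡ xs → x + c ≤ K) → c ≤ K → maxL xs + c ≤ K
maxL-lub+ []       c K h c≤K = c≤K
maxL-lub+ (y ∷ ys) c K h c≤K = subst (_≤ K) (sym (+-distribʳ-⊔ c y (maxL ys)))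
  (⊔-lub (h y (here refl)) (maxL-lub+ ys c K (λ x x∈ → h x (there x∈)) c≤K))

foldr⊓-≤-seed : ∀ y (ys : List ℕ) → foldr _⊓_ y ys ≤ y
foldr⊓-≤-seed y []       = ≤-refl
foldr⊓-≤-seed y (z ∷ zs) = ≤-trans (m⊓n≤n z _) (foldr⊓-≤-seed y zs)

foldr⊓-≤ : ∀ {x} y (ys : List ℕ) → x ∈ˡ ys → foldr _⊓_ y ys ≤ x
foldr⊓-≤ y (z ∷ zs) (here refl) = m⊓n≤m z _
foldr⊓-≤ y (z ∷ zs) (there x∈)  = ≤-trans (m⊓n≤n z _) (foldr⊓-≤ y zs x∈)

minL-lb : ∀ {x} (xs : List ℕ) → x ∈ˡ xs → minL xs ≤ x
minL-lb (y ∷ ys) (here refl) = foldr⊓-≤-seed y ys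
minL-lb (y ∷ ys) (there x∈)  = foldr⊓-≤ y ys x∈

minL-∈ : ∀ {x} (xs : List ℕ) → x ∈ˡ xs → minL xs ∈ˡ xs
minL-∈ (y ∷ ys) _ = attained y ys
  where
  attained : ∀ y ys → foldr _⊓_ y ys ∈ˡ (y ∷ ys)
  attained y []       = here refl
  attained y (z ∷ zs) with ⊓-sel z (foldr _⊓_ y zs)
  ... | inj₁ e = subst (_∈ˡ (y ∷ z ∷ zs)) (sym e) (there (here refl))
  ... | inj₂ e with attained y zs
  ...   | here y≡    = subst (_∈ˡ (y ∷ z ∷ zs)) (sym e) (here y≡)
  ...   | there in-zs = subst (_∈ˡ (y ∷ z ∷ zs)) (sym e) (there (there in-zs))

module _ {A : Set} where

  bfilter⁺ : ∀ (P : A → Bool) {x} (xs : List A) → x ∈ˡ xs → P x ≡ true → x ∈ˡ bfilter P xs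
  bfilter⁺ P (y ∷ ys) (here refl) Px rewrite Px = here refl
  bfilter⁺ P (y ∷ ys) (there x∈)  Px with P y
  ... | true  = there (bfilter⁺ P ys x∈ Px)
  ... | false = bfilter⁺ P ys x∈ Px

  bfilter⁻ : ∀ (P : A → Bool) {x} (xs : List A) → x ∈ˡ bfilter P xs → P x ≡ true
  bfilter⁻ P (y ∷ ys) x∈ with P y in Py
  bfilter⁻ P (y ∷ ys) (here refl) | true  = Py
  bfilter⁻ P (y ∷ ys) (there x∈)  | true  = bfilter⁻ P ys x∈
  bfilter⁻ P (y ∷ ys) x∈          | false = bfilter⁻ P ys x∈

  allB⁻ : ∀ (P : A → Bool) (xs : List A) → allB P xs ≡ true → ∀ {x} → x ∈ˡ xs → P x ≡ true
  allB⁻ P (y ∷ ys) all (here refl) = ∧-conicalˡ (P y) _ all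
  allB⁻ P (y ∷ ys) all (there x∈)  = allB⁻ P ys (∧-conicalʳ (P y) _ all) x∈

  allB⁺ : ∀ (P : A → Bool) (xs : List A) → (∀ x → x ∈ˡ xs → P x ≡ true) → allB P xs ≡ true
  allB⁺ P []       h = refl
  allB⁺ P (y ∷ ys) h rewrite h y (here refl) = allB⁺ P ys (λ x x∈ → h x (there x∈))

  anyB⁻ : ∀ (P : A → Bool) (xs : List A) → anyB P xs ≡ true → ∃ λ x → P x ≡ true
  anyB⁻ P (y ∷ ys) any with P y in Py
  ... | true  = y , Py
  ... | false = anyB⁻ P ys any

  anyB⁺ : ∀ (P : A → Bool) (xs : List A) {x} → x ∈ˡ xs → P x ≡ true → anyB P xs ≡ true
  anyB⁺ P (y ∷ ys) (here refl) Px rewrite Px = refl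
  anyB⁺ P (y ∷ ys) (there x∈)  Px with P y
  ... | true  = refl
  ... | false = anyB⁺ P ys x∈ Px

allSubsets-complete : ∀ (p : Subset m) → p ∈ˡ allSubsets m
allSubsets-complete []            = here refl
allSubsets-complete (inside ∷ p)  = ∈-++⁺ˡ (∈-map⁺ (inside ∷_) (allSubsets-complete p))
allSubsets-complete {suc m} (outside ∷ p) =
  ∈-++⁺ʳ (map (inside ∷_) (allSubsets m)) (∈-map⁺ (outside ∷_) (allSubsets-complete p))

subsetB⇔ : ∀ (p q : Subset m) → (subsetB p q ≡ true → p ⊆ q) × (p ⊆ q → subsetB p q ≡ true)
subsetB⇔ {m} p q = (λ t x∈p → member⇒∈ (implies (allB⁻ _ (allFin m) t (∈-allFin _)) (∈⇒member x∈p)))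
                 , (λ p⊆q → allB⁺ _ (allFin m) (λ x _ → implied (∈⇒member ∘ p⊆q ∘ member⇒∈)))
  where
  implies : ∀ {a b} → (not a ∨ b) ≡ true → a ≡ true → b ≡ true
  implies {true} b refl = b
  implied : ∀ {a b} → (a ≡ true → b ≡ true) → (not a ∨ b) ≡ true
  implied {true}  h = h refl
  implied {false} h = refl

nonemptyB⇔ : ∀ (p : Subset m) → (nonemptyB p ≡ true → Nonempty p) × (Nonempty p → nonemptyB p ≡ true)
nonemptyB⇔ {m} p = (λ t → let x , x∈ = anyB⁻ _ (allFin m) t in x , member⇒∈ x∈)
                 , (λ (x , x∈p) → anyB⁺ _ (allFin m) (∈-allFin x) (∈⇒member x∈p))

Independent : (G : Graph) → Subset (n G) → Set
Independent G X = ∀ {u w} → u ∈ X → w ∈ X → adj G u w ≡ false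

independentB⇔ : ∀ G (X : Subset (n G)) →
  (independentB G X ≡ true → Independent G X) × (Independent G X → independentB G X ≡ true)
independentB⇔ G X =
    (λ t {u} {w} u∈ w∈ → noEdge (allB⁻ _ (allFin (n G)) (allB⁻ _ (allFin (n G)) t (∈-allFin u)) (∈-allFin w))
                                (∈⇒member u∈) (∈⇒member w∈))
  , (λ ind → allB⁺ _ (allFin (n G)) λ u _ → allB⁺ _ (allFin (n G)) λ w _ →
       noEdge⁺ (λ u∈ w∈ → ind (member⇒∈ u∈) (member⇒∈ w∈)))
  where
  noEdge : ∀ {a b e} → not (a ∧ b ∧ e) ≡ true → a ≡ true → b ≡ true → e ≡ false
  noEdge {e = false} _ refl refl = refl
  noEdge⁺ : ∀ {a b e} → (a ≡ true → b ≡ true → e ≡ false) → not (a ∧ b ∧ e) ≡ true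
  noEdge⁺ {true}  {true} h rewrite h refl refl = refl
  noEdge⁺ {true}  {false} h = refl
  noEdge⁺ {false} h = refl

Response : (G : Graph) → Subset (n G) → Subset (n G) → Set
Response G M X = X ⊆ M × Nonempty X × Independent G X

markings⁻ : ∀ (U M : Subset m) → M ∈ˡ markings U → M ⊆ U × Nonempty M
markings⁻ {m} U M M∈ = let t = bfilter⁻ _ (allSubsets m) M∈ in
  proj₁ (subsetB⇔ M U) (∧-conicalˡ _ _ t) , proj₁ (nonemptyB⇔ M) (∧-conicalʳ _ _ t)

markings⁺ : ∀ (U M : Subset m) → M ⊆ U → Nonempty M → M ∈ˡ markings U
markings⁺ {m} U M M⊆U ne = bfilter⁺ _ (allSubsets m) (allSubsets-complete M)
  (cong₂ _∧_ (proj₂ (subsetB⇔ M U) M⊆U) (proj₂ (nonemptyB⇔ M) ne))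

responses⁻ : ∀ G (M X : Subset (n G)) → X ∈ˡ responses G M → Response G M X
responses⁻ G M X X∈ = let t = bfilter⁻ _ (allSubsets (n G)) X∈; t′ = ∧-conicalʳ (subsetB X M) _ t in
    proj₁ (subsetB⇔ X M) (∧-conicalˡ _ _ t)
  , proj₁ (nonemptyB⇔ X) (∧-conicalˡ _ _ t′)
  , proj₁ (independentB⇔ G X) (∧-conicalʳ _ _ t′)

responses⁺ : ∀ G (M X : Subset (n G)) → Response G M X → X ∈ˡ responses G M
responses⁺ G M X (X⊆M , ne , ind) = bfilter⁺ _ (allSubsets (n G)) (allSubsets-complete X)
  (cong₂ _∧_ (proj₂ (subsetB⇔ X M) X⊆M)
    (cong₂ _∧_ (proj₂ (nonemptyB⇔ X) ne) (proj₂ (independentB⇔ G X) ind)))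

module _ (G : Graph) where

  singletonResponse : ∀ {M : Subset (n G)} {x} → x ∈ M → Response G M ⁅ x ⁆
  singletonResponse {x = x} x∈M = x∈p⇒⁅x⁆⊆p x∈M , (x , x∈⁅x⁆ x) , noLoop
    where
    noLoop : Independent G ⁅ x ⁆
    noLoop u∈ w∈ rewrite x∈⁅y⁆⇒x≡y x u∈ | x∈⁅y⁆⇒x≡y x w∈ = irrefl G x

  afterCost : ℕ → Subset (n G) → Subset (n G) → ℕ
  afterCost f U X = gameValue G f (U ─ X)

  markValue : ℕ → Subset (n G) → Subset (n G) → ℕ
  markValue f U M = ∣ M ∣ + minL (map (afterCost f U) (responses G M))

  painterBound+ : ∀ f U c K → c ≤ K →
    (∀ M → M ⊆ U → Nonempty M → ∃ λ X → Response G M X × ∣ M ∣ + gameValue G f (U ─ X) + c ≤ K) →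
    gameValue G (suc f) U + c ≤ K
  painterBound+ f U c K c≤K answer = maxL-lub+ (map (markValue f U) (markings U)) c K bound c≤K
    where
    bound : ∀ y → y ∈ˡ map (markValue f U) (markings U) → y + c ≤ K
    bound y y∈ with ∈-map⁻ (markValue f U) y∈
    ... | M , M∈ , refl with markings⁻ U M M∈
    ... | M⊆U , ne with answer M M⊆U ne
    ... | X , resp , cost = ≤-trans (+-monoˡ-≤ c (+-monoʳ-≤ ∣ M ∣ (minL-lb _
            (∈-map⁺ (afterCost f U) (responses⁺ G M X resp))))) cost

  painterBound : ∀ f U K →
    (∀ M → M ⊆ U → Nonempty M → ∃ λ X → Response G M X × ∣ M ∣ + gameValue G f (U ─ X) ≤ K) →
    gameValue G (suc f) U ≤ K
  painterBound f U K answer = subst (_≤ K) (+-identityʳ _) (painterBound+ f U 0 K z≤n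
    λ M M⊆U ne → let X , resp , cost = answer M M⊆U ne in X , resp , subst (_≤ K) (sym (+-identityʳ _)) cost)

  optimalResponse : ∀ f U M → M ⊆ U → Nonempty M →
    ∃ λ X → Response G M X × ∣ M ∣ + gameValue G f (U ─ X) ≤ gameValue G (suc f) U
  optimalResponse f U M M⊆U (x , x∈M)
    with ∈-map⁻ (afterCost f U) (minL-∈ (map (afterCost f U) (responses G M))
           (∈-map⁺ (afterCost f U) (responses⁺ G M ⁅ x ⁆ (singletonResponse x∈M))))
  ... | X , X∈ , minimal = X , responses⁻ G M X X∈ ,
    subst (λ v → ∣ M ∣ + v ≤ gameValue G (suc f) U) minimal
      (maxL-ub (map (markValue f U) (markings U)) (∈-map⁺ (markValue f U) (markings⁺ U M M⊆U (x , x∈M))))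

  listerBound : ∀ f U M K → M ⊆ U → Nonempty M →
    (∀ X → Response G M X → K ≤ ∣ M ∣ + gameValue G f (U ─ X)) → K ≤ gameValue G (suc f) U
  listerBound f U M K M⊆U ne forced with optimalResponse f U M M⊆U ne
  ... | X , resp , cost = ≤-trans (forced X resp) cost

module _ (G : Graph) where

  private
    g : ℕ → Subset (n G) → ℕ
    g = gameValue G

  fuel-step : ∀ f U → g f U ≤ g (suc f) U
  fuel-step zero    U = z≤n
  fuel-step (suc f) U = painterBound G f U _ λ M M⊆U ne →
    let X , resp , cost = optimalResponse G (suc f) U M M⊆U ne in
    X , resp , ≤-trans (+-monoʳ-≤ ∣ M ∣ (fuel-step f (U ─ X))) cost

  fuel-mono : ∀ k f U → g f U ≤ g (k + f) U
  fuel-mono zero    f U = ≤-refl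
  fuel-mono (suc k) f U = ≤-trans (fuel-mono k f U) (fuel-step (k + f) U)

  -- Each round colours a vertex, so fuel ∣ U ∣ already gives the true value.
  fuel-enough : ∀ f U → ∣ U ∣ ≤ f → g (suc f) U ≤ g f U
  fuel-enough zero    U ∣U∣≤0 = painterBound G zero U 0 λ M M⊆U ne →
    ⊥-elim (1+n≰n (≤-trans (nonempty⇒∣p∣≥1 M ne) (≤-trans (p⊆q⇒∣p∣≤∣q∣ M⊆U) ∣U∣≤0)))
  fuel-enough (suc f) U ∣U∣≤ = painterBound G (suc f) U _ λ M M⊆U ne →
    let X , resp@(X⊆M , neX , _) , cost = optimalResponse G f U M M⊆U ne in
    X , resp , ≤-trans (+-monoʳ-≤ ∣ M ∣ (fuel-enough f (U ─ X)
      (≤-pred (≤-trans (∣p─q∣<∣p∣ U X (M⊆U ∘ X⊆M) neX) ∣U∣≤)))) cost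

  fuel-enough* : ∀ k f U → ∣ U ∣ ≤ f → g (k + f) U ≤ g f U
  fuel-enough* zero    f U ∣U∣≤ = ≤-refl
  fuel-enough* (suc k) f U ∣U∣≤ =
    ≤-trans (fuel-enough (k + f) U (≤-trans ∣U∣≤ (m≤n+m f k))) (fuel-enough* k f U ∣U∣≤)

  -- Lister can always mark everything at once, so the value is at least ∣ U ∣.
  gameValue-≥-size : ∀ f U → ∣ U ∣ ≤ f → ∣ U ∣ ≤ g f U
  gameValue-≥-size f U ∣U∣≤ with ∣ U ∣ in ∣U∣≡
  ... | zero  = z≤n
  ... | suc s with f | ∣U∣≤
  ...   | suc f′ | _ = subst (_≤ g (suc f′) U) ∣U∣≡
          (listerBound G f′ U U ∣ U ∣ (λ x∈ → x∈) (∣p∣≥1⇒nonempty U (subst (1 ≤_) (sym ∣U∣≡) (s≤s z≤n)))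
            λ X _ → m≤m+n ∣ U ∣ _)

  gameValue-⊥ : ∀ f → g f ⊥ ≡ 0
  gameValue-⊥ zero    = refl
  gameValue-⊥ (suc f) = n≤0⇒n≡0 (painterBound G f ⊥ 0 λ M M⊆⊥ (x , x∈M) → ⊥-elim (∉⊥ (M⊆⊥ x∈M)))

  -- Monotonicity: Painter answers on the smaller set as on the larger one.
  gameValue-mono : ∀ f B U → B ⊆ U → g f B ≤ g f U
  gameValue-mono zero    B U B⊆U = z≤n
  gameValue-mono (suc f) B U B⊆U = painterBound G f B _ λ M M⊆B ne →
    let X , resp , cost = optimalResponse G f U M (B⊆U ∘ M⊆B) ne in
    X , resp , ≤-trans (+-monoʳ-≤ ∣ M ∣ (gameValue-mono f (B ─ X) (U ─ X) (─-monoˡ B U X B⊆U))) cost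

  -- Superadditivity over disjoint parts: Lister plays the game on A first
  -- and, whatever Painter does there, the untouched game on B afterwards.
  superadditive : ∀ fa fb A B U → A ⊆ U → B ⊆ U → Disjoint A B →
    g fa A + g fb B ≤ g (fa + fb) U
  superadditive zero     fb A B U A⊆U B⊆U A∩B=∅ = gameValue-mono fb B U B⊆U
  superadditive (suc fa) fb A B U A⊆U B⊆U A∩B=∅ =
    painterBound+ G fa A (g fb B) _ g[B]≤ λ M M⊆A ne →
      let X , resp@(X⊆M , _) , cost = optimalResponse G (fa + fb) U M (A⊆U ∘ M⊆A) ne
          B⊆U─X : B ⊆ U ─ X
          B⊆U─X x∈B = x∈p∧x∉q⇒x∈p─q (B⊆U x∈B) (λ x∈X → A∩B=∅ (M⊆A (X⊆M x∈X)) x∈B)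
      in X , resp , (begin
        ∣ M ∣ + g fa (A ─ X) + g fb B   ≡⟨ +-assoc ∣ M ∣ _ _ ⟩
        ∣ M ∣ + (g fa (A ─ X) + g fb B) ≤⟨ +-monoʳ-≤ ∣ M ∣ (superadditive fa fb (A ─ X) B (U ─ X)
                                             (─-monoˡ A U X A⊆U) B⊆U─X (A∩B=∅ ∘ p─q⊆p A X)) ⟩
        ∣ M ∣ + g (fa + fb) (U ─ X)     ≤⟨ cost ⟩
        g (suc (fa + fb)) U             ∎)
    where
    open ≤-Reasoning
    g[B]≤ : g fb B ≤ g (suc (fa + fb)) U
    g[B]≤ = ≤-trans (gameValue-mono fb B U B⊆U) (fuel-mono (suc fa) fb U)

-- Triangular numbers.  tri k = 1 + 2 + ⋯ + k, and the paper's t_k is tri k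
-- for k ≥ 1.  triRoot x is the largest k with tri k ≤ x; it is the number
-- of leaves Lister marks together with the centre of a star.

tri : ℕ → ℕ
tri zero    = 0
tri (suc k) = suc k + tri k

tri≡C : ∀ k → tri k ≡ suc k C 2
tri≡C zero    = refl
tri≡C (suc k) = trans (cong₂ _+_ (sym (nC1≡n (suc k))) (tri≡C k)) (nCk+nC[k+1]≡[n+1]C[k+1] (suc k) 1)

tri-mono : ∀ {k l} → k ≤ l → tri k ≤ tri l
tri-mono {zero}          _         = z≤n
tri-mono {suc k} {suc l} (s≤s k≤l) = s≤s (+-mono-≤ k≤l (tri-mono k≤l))

triDecomp : ∀ x → ∃ λ k → ∃ λ d → d ≤ k × x ≡ tri k + d
triDecomp zero = 0 , 0 , z≤n , refl
triDecomp (suc x) with triDecomp x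
... | k , d , d≤k , x≡ with d ≟ k
...   | yes refl = suc d , 0 , z≤n , cong suc (trans x≡ (trans (+-comm (tri d) d) (sym (+-identityʳ _))))
...   | no  d≢k  = k , suc d , ≤∧≢⇒< d≤k d≢k , trans (cong suc x≡) (sym (+-suc (tri k) d))

triRoot : ℕ → ℕ
triRoot x = proj₁ (triDecomp x)

tri-triRoot≤ : ∀ x → tri (triRoot x) ≤ x
tri-triRoot≤ x with triDecomp x
... | k , d , _ , x≡ = subst (tri k ≤_) (sym x≡) (m≤m+n (tri k) d)

<tri-suc-triRoot : ∀ x → x < tri (suc (triRoot x))
<tri-suc-triRoot x with triDecomp x
... | k , d , d≤k , x≡ = subst (_< tri (suc k)) (sym x≡)
  (subst (tri k + d <_) (+-comm (tri k) (suc k)) (+-monoʳ-< (tri k) (s≤s d≤k)))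

triRoot-≥ : ∀ {k x} → tri k ≤ x → k ≤ triRoot x
triRoot-≥ {k} {x} tk≤x with k ≤? triRoot x
... | yes k≤ = k≤
... | no  k≰ = ⊥-elim (<⇒≱ (<tri-suc-triRoot x) (≤-trans (tri-mono (≰⇒> k≰)) tk≤x))

triRoot-< : ∀ {k x} → x < tri k → triRoot x < k
triRoot-< {k} {x} x<tk with triRoot x <? k
... | yes r<k = r<k
... | no  r≮k = ⊥-elim (<⇒≱ x<tk (≤-trans (tri-mono (≮⇒≥ r≮k)) (tri-triRoot≤ x)))

triRoot-mono : ∀ {x y} → x ≤ y → triRoot x ≤ triRoot y
triRoot-mono {x} x≤y = triRoot-≥ (≤-trans (tri-triRoot≤ x) x≤y)

triRoot≤ : ∀ x → triRoot x ≤ x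
triRoot≤ x = ≤-trans (k≤tri (triRoot x)) (tri-triRoot≤ x)
  where
  k≤tri : ∀ k → k ≤ tri k
  k≤tri zero    = z≤n
  k≤tri (suc k) = m≤m+n (suc k) (tri k)

triRoot-drop : ∀ x y → triRoot x + y < x → triRoot y < triRoot x
triRoot-drop x y r+y<x = triRoot-< (+-cancelʳ-< (triRoot x) y (tri (triRoot x))
  (≤-trans (subst (_< x) (+-comm (triRoot x) y) r+y<x)
    (subst (x ≤_) (+-comm (triRoot x) (tri (triRoot x))) (≤-pred (<tri-suc-triRoot x)))))

triRoot-∸ : ∀ x → triRoot x ≤ suc (triRoot (x ∸ triRoot x))
triRoot-∸ x with triRoot x | tri-triRoot≤ x
... | zero  | _     = z≤n
... | suc k | tk≤x = s≤s (triRoot-≥ (m+n≤o⇒m≤o∸n (tri k) (subst (_≤ x) (+-comm (suc k) (tri k)) tk≤x)))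

nonTriangular⇒triRoot-suc : ∀ r → ¬ Triangular (suc r) → triRoot (suc r) ≡ triRoot r
nonTriangular⇒triRoot-suc r ¬tri with triRoot (suc r) ≟ triRoot r
... | yes eq  = eq
... | no  neq = ⊥-elim (¬tri (suc (triRoot r) , s≤s z≤n , trans (sym r+1≡tri) (tri≡C (suc (triRoot r)))))
  where
  grows : suc (triRoot r) ≤ triRoot (suc r)
  grows = ≤∧≢⇒< (triRoot-mono (n≤1+n r)) (neq ∘ sym)
  r+1≡tri : tri (suc (triRoot r)) ≡ suc r
  r+1≡tri = ≤-antisym (≤-trans (tri-mono grows) (tri-triRoot≤ (suc r))) (<tri-suc-triRoot r)

-- The cost of a star.  starValue j = s̊(K_{1,j}).  starCost bounds the cost
-- of the star part of a stem: the flags say whether the centre is still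
-- uncoloured and whether its non-leaf neighbour w is; j counts the leaves.
-- While w is available, Lister may mark one more leaf with the centre.

starValue : ℕ → ℕ
starValue j = suc (j + triRoot j)

leafQuota : Bool → ℕ → ℕ
leafQuota false j = triRoot j
leafQuota true  j = triRoot (suc j)

starCost : Bool → Bool → ℕ → ℕ
starCost false _ j = j
starCost true  w j = suc (j + leafQuota w j)

leafQuota-mono : ∀ {w′ w j′ j} → w′ ≤ᵇ w → j′ ≤ j → leafQuota w′ j′ ≤ leafQuota w j
leafQuota-mono {false} {false} _   j′≤j = triRoot-mono j′≤j
leafQuota-mono {false} {true}  f≤t j′≤j = triRoot-mono (m≤n⇒m≤1+n j′≤j)
leafQuota-mono {true}  {true}  b≤b j′≤j = triRoot-mono (s≤s j′≤j)

starCost-≥ : ∀ c w j → j ≤ starCost c w j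
starCost-≥ false w j = ≤-refl
starCost-≥ true  w j = m≤n⇒m≤1+n (m≤m+n j _)

starCost-mono : ∀ {c′ c w′ w j′ j} → c′ ≤ᵇ c → w′ ≤ᵇ w → j′ ≤ j → starCost c′ w′ j′ ≤ starCost c w j
starCost-mono {false} {c} {w = w} {j = j} _ _ j′≤j = ≤-trans j′≤j (starCost-≥ c w j)
starCost-mono {true}  {true} b≤b w′≤w j′≤j = s≤s (+-mono-≤ j′≤j (leafQuota-mono w′≤w j′≤j))

starCost-monoʳ : ∀ c w {j′ j} → j′ ≤ j → starCost c w j′ ≤ starCost c w j
starCost-monoʳ c w = starCost-mono {c} {c} {w} {w} b≤b b≤b

-- Without the exceptional case r + 1 = t_k, the neighbour w is worthless.
starCost-nonTriangular : ∀ r → ¬ Triangular (suc r) → ∀ w → starCost true w r ≤ starValue r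
starCost-nonTriangular r ¬tri false = ≤-refl
starCost-nonTriangular r ¬tri true  = ≤-reflexive (cong (λ q → suc (r + q)) (nonTriangular⇒triRoot-suc r ¬tri))

-- Colouring m leaves is paid for by the m points Lister spent on them.
absorbLeaves : ∀ {c′ c w′ w} m j′ → c′ ≤ᵇ c → w′ ≤ᵇ w → m + starCost c′ w′ j′ ≤ starCost c w (m + j′)
absorbLeaves {false} {c} {w = w} m j′ _ _ = starCost-≥ c w (m + j′)
absorbLeaves {true} {true} {w′} {w} m j′ b≤b w′≤w = begin
  m + suc (j′ + leafQuota w′ j′)    ≡⟨ +-suc m _ ⟩
  suc (m + (j′ + leafQuota w′ j′))  ≡⟨ cong suc (sym (+-assoc m j′ _)) ⟩
  suc (m + j′ + leafQuota w′ j′)    ≤⟨ s≤s (+-monoʳ-≤ (m + j′) (leafQuota-mono w′≤w (m≤n+m j′ m))) ⟩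
  suc (m + j′ + leafQuota w (m + j′)) ∎
  where open ≤-Reasoning

private
  rearrange : ∀ m j a → suc m + suc (j + a) ≡ suc (m + j + suc a)
  rearrange = solve-∀

-- More than leafQuota marked leaves: the quota itself drops by one.
leavesBeyondQuota : ∀ {w′ w} m j′ → w′ ≤ᵇ w → leafQuota w (m + j′) < m →
  suc m + starCost true w′ j′ ≤ starCost true w (m + j′)
leavesBeyondQuota {w′} {w} m j′ w′≤w q<m = begin
  suc m + starCost true w′ j′         ≤⟨ +-monoʳ-≤ (suc m) (starCost-mono {j′ = j′} b≤b w′≤w ≤-refl) ⟩
  suc m + suc (j′ + leafQuota w j′)   ≡⟨ rearrange m j′ _ ⟩
  suc (m + j′ + suc (leafQuota w j′)) ≤⟨ s≤s (+-monoʳ-≤ (m + j′) (quotaDrops w q<m)) ⟩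
  suc (m + j′ + leafQuota w (m + j′)) ∎
  where
  open ≤-Reasoning
  quotaDrops : ∀ w → leafQuota w (m + j′) < m → leafQuota w j′ < leafQuota w (m + j′)
  quotaDrops false q<m = triRoot-drop (m + j′) j′ (+-monoˡ-< j′ q<m)
  quotaDrops true  q<m = triRoot-drop (suc (m + j′)) (suc j′)
    (subst (triRoot (suc (m + j′)) + suc j′ <_) (+-suc m j′) (+-monoˡ-< (suc j′) q<m))

-- Within the quota, Painter colours the centre.
centreWithinQuota : ∀ w m j → m ≤ leafQuota w j → suc m + j ≤ starCost true w j
centreWithinQuota w m j m≤q = s≤s (subst (_≤ j + leafQuota w j) (+-comm j m) (+-monoʳ-≤ j m≤q))

-- Room for one more leaf thanks to w: Painter colours the centre and
-- spends one extra point by not colouring w.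
centreSparingW : ∀ m j → suc m ≤ triRoot (suc j) → suc (suc m + j) ≤ starCost true true j
centreSparingW m j m<q = s≤s (subst (_≤ j + triRoot (suc j)) (+-comm j (suc m)) (+-monoʳ-≤ j m<q))

-- Exactly at the quota with w present: colouring the leaves and w together
-- turns the bound back into starValue.
leavesAtQuota : ∀ m j′ → triRoot (suc (m + j′)) ≤ m → suc m + starValue j′ ≤ starCost true true (m + j′)
leavesAtQuota m j′ q≤m = begin
  suc m + suc (j′ + triRoot j′)   ≡⟨ rearrange m j′ _ ⟩
  suc (m + j′ + suc (triRoot j′)) ≤⟨ s≤s (+-monoʳ-≤ (m + j′) (triRoot-drop (suc (m + j′)) j′
                                       (s≤s (+-monoˡ-≤ j′ q≤m)))) ⟩
  suc (m + j′ + triRoot (suc (m + j′))) ∎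
  where open ≤-Reasoning

-- The recursion behind Lister's strategy on a star: he pays 1 + triRoot j
-- for marking the centre and triRoot j leaves, and if Painter colours only
-- leaves, at least j ∸ triRoot j leaves and the centre remain.
starValue-step : ∀ j j′ → j ∸ triRoot j ≤ j′ → starValue j ≤ suc (triRoot j) + starValue j′
starValue-step j j′ d≤j′ = ≤-trans (s≤s main) (+-monoʳ-≤ (suc k) (s≤s (+-mono-≤ d≤j′ (triRoot-mono d≤j′))))
  where
  k d : ℕ
  k = triRoot j
  d = j ∸ k
  open ≤-Reasoning
  main : j + k ≤ k + suc (d + triRoot d)
  main = begin
    j + k                     ≡⟨ cong (_+ k) (sym (m+[n∸m]≡n (triRoot≤ j))) ⟩
    k + d + k                 ≡⟨ +-assoc k d k ⟩
    k + (d + k)               ≤⟨ +-monoʳ-≤ k (+-monoʳ-≤ d (triRoot-∸ j)) ⟩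
    k + (d + suc (triRoot d)) ≡⟨ cong (k +_) (+-suc d _) ⟩
    k + suc (d + triRoot d)   ∎

-- Lister's strategy on a star with centre c whose other vertices are
-- leaves adjacent to c: mark the centre with triRoot j of the j leaves.
-- This gives the lower bound s̊(K_{1,j}) ≥ starValue j.
module StarLower (G : Graph) (c : Fin (n G)) (L : Subset (n G))
                 (c~L : ∀ {x} → x ∈ L → adj G c x ≡ true) where

  InStar : Subset (n G) → Set
  InStar U = ∀ {x} → x ∈ U → x ∈ L ⊎ x ≡ c

  record StarMark (U : Subset (n G)) (k : ℕ) : Set where
    field
      M           : Subset (n G)
      M⊆U         : M ⊆ U
      c∈M         : c ∈ M
      size        : suc k ≤ ∣ M ∣
      centreAlone : ∀ {X} → X ⊆ M → Independent G X → c ∈ X → X ⊆ ⁅ c ⁆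
      fewLeaves   : ∀ {X} → X ⊆ M → c ∉ X → ∣ X ∣ ≤ k

  starMark : ∀ U j → InStar U → c ∈ U → ∣ U ∣ ≡ suc j → ∀ k → k ≤ j → StarMark U k
  starMark U j U-star c∈U ∣U∣≡ k k≤j = record
    { M = M ; M⊆U = M⊆U ; c∈M = c∈M ; size = size ; centreAlone = centreAlone ; fewLeaves = fewLeaves }
    where
    ∣U─c∣≡j : ∣ U ─ ⁅ c ⁆ ∣ ≡ j
    ∣U─c∣≡j = suc-injective (begin-equality
      suc ∣ U ─ ⁅ c ⁆ ∣             ≡⟨ cong (_+ ∣ U ─ ⁅ c ⁆ ∣) (sym (∣⁅x⁆∣≡1 c)) ⟩
      ∣ ⁅ c ⁆ ∣ + ∣ U ─ ⁅ c ⁆ ∣     ≡⟨ sym (∣p∣≡∣q∣+∣p─q∣ U ⁅ c ⁆ (x∈p⇒⁅x⁆⊆p c∈U)) ⟩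
      ∣ U ∣                         ≡⟨ ∣U∣≡ ⟩
      suc j                         ∎)
      where open ≤-Reasoning
    chosen : ∃ λ B → B ⊆ U ─ ⁅ c ⁆ × ∣ B ∣ ≡ k
    chosen = subsetOfSize (U ─ ⁅ c ⁆) k (subst (k ≤_) (sym ∣U─c∣≡j) k≤j)
    B : Subset (n G)
    B = proj₁ chosen
    B⊆U─c : B ⊆ U ─ ⁅ c ⁆
    B⊆U─c = proj₁ (proj₂ chosen)
    M : Subset (n G)
    M = B ∪ ⁅ c ⁆
    c∈M : c ∈ M
    c∈M = x∈p∪q⁺ (inj₂ (x∈⁅x⁆ c))
    c∉B : c ∉ B
    c∉B c∈B = x∈p─q⇒x∉q U ⁅ c ⁆ (B⊆U─c c∈B) (x∈⁅x⁆ c)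
    B⊆L : B ⊆ L
    B⊆L {x} x∈B with U-star (p─q⊆p U ⁅ c ⁆ (B⊆U─c x∈B))
    ... | inj₁ x∈L  = x∈L
    ... | inj₂ refl = ⊥-elim (c∉B x∈B)
    M⊆U : M ⊆ U
    M⊆U x∈M with x∈p∪q⁻ B ⁅ c ⁆ x∈M
    ... | inj₁ x∈B = p─q⊆p U ⁅ c ⁆ (B⊆U─c x∈B)
    ... | inj₂ x∈c = subst (_∈ U) (sym (x∈⁅y⁆⇒x≡y c x∈c)) c∈U
    size : suc k ≤ ∣ M ∣
    size = subst₂ (λ a b → a + b ≤ ∣ M ∣) (∣⁅x⁆∣≡1 c) (proj₂ (proj₂ chosen))
      (disjoint-size ⁅ c ⁆ B M (x∈p⇒⁅x⁆⊆p c∈M) (λ x∈B → x∈p∪q⁺ (inj₁ x∈B))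
        (λ x∈c x∈B → c∉B (subst (_∈ B) (x∈⁅y⁆⇒x≡y c x∈c) x∈B)))
    -- the centre is adjacent to every marked leaf
    centreAlone : ∀ {X} → X ⊆ M → Independent G X → c ∈ X → X ⊆ ⁅ c ⁆
    centreAlone X⊆M indX c∈X {x} x∈X with x∈p∪q⁻ B ⁅ c ⁆ (X⊆M x∈X)
    ... | inj₂ x∈c = x∈c
    ... | inj₁ x∈B with trans (sym (c~L (B⊆L x∈B))) (indX c∈X x∈X)
    ...   | ()
    fewLeaves : ∀ {X} → X ⊆ M → c ∉ X → ∣ X ∣ ≤ k
    fewLeaves {X} X⊆M c∉X = subst (∣ X ∣ ≤_) (proj₂ (proj₂ chosen)) (p⊆q⇒∣p∣≤∣q∣ X⊆B)
      where
      X⊆B : X ⊆ B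
      X⊆B {x} x∈X with x∈p∪q⁻ B ⁅ c ⁆ (X⊆M x∈X)
      ... | inj₁ x∈B = x∈B
      ... | inj₂ x∈c = ⊥-elim (c∉X (subst (_∈ X) (x∈⁅y⁆⇒x≡y c x∈c) x∈X))

  centreColoured : ∀ f U j X → ∣ U ∣ ≡ suc j → j ≤ f → X ⊆ U → X ⊆ ⁅ c ⁆ → Nonempty X →
    j ≤ gameValue G f (U ─ X)
  centreColoured f U j X ∣U∣≡ j≤f X⊆U X⊆c neX = ≤-trans j≤∣U─X∣ (gameValue-≥-size G f (U ─ X)
      (≤-pred (≤-trans (∣p─q∣<∣p∣ U X X⊆U neX) (≤-trans (≤-reflexive ∣U∣≡) (s≤s j≤f)))))
    where
    open ≤-Reasoning
    j≤∣U─X∣ : j ≤ ∣ U ─ X ∣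
    j≤∣U─X∣ = ≤-pred (begin
      suc j                 ≡⟨ sym ∣U∣≡ ⟩
      ∣ U ∣                 ≡⟨ ∣p∣≡∣q∣+∣p─q∣ U X X⊆U ⟩
      ∣ X ∣ + ∣ U ─ X ∣     ≤⟨ +-monoˡ-≤ _ (≤-trans (p⊆q⇒∣p∣≤∣q∣ X⊆c) (≤-reflexive (∣⁅x⁆∣≡1 c))) ⟩
      suc ∣ U ─ X ∣         ∎)

  leavesColoured : ∀ (U : Subset (n G)) j X → ∣ U ∣ ≡ suc j → X ⊆ U → Nonempty X → ∣ X ∣ ≤ triRoot j →
    ∃ λ j′ → ∣ U ─ X ∣ ≡ suc j′ × j ∸ triRoot j ≤ j′ × j′ < j
  leavesColoured U j X ∣U∣≡ X⊆U neX ∣X∣≤k with ∣ U ─ X ∣ in ∣U─X∣≡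
  ... | zero = ⊥-elim (<⇒≱ (s≤s (triRoot≤ j)) (≤-trans (≤-reflexive
                 (trans split (trans (cong (∣ X ∣ +_) ∣U─X∣≡) (+-identityʳ _)))) ∣X∣≤k))
    where
    split : suc j ≡ ∣ X ∣ + ∣ U ─ X ∣
    split = trans (sym ∣U∣≡) (∣p∣≡∣q∣+∣p─q∣ U X X⊆U)
  ... | suc j′ = j′ , refl , j∸k≤j′ , j′<j
    where
    j≡ : j ≡ ∣ X ∣ + j′
    j≡ = suc-injective (trans (sym ∣U∣≡) (trans (∣p∣≡∣q∣+∣p─q∣ U X X⊆U)
           (trans (cong (∣ X ∣ +_) ∣U─X∣≡) (+-suc _ j′))))
    j∸k≤j′ : j ∸ triRoot j ≤ j′
    j∸k≤j′ = subst (j ∸ triRoot j ≤_) (m+n∸m≡n (triRoot j) j′)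
      (∸-monoˡ-≤ (triRoot j) (≤-trans (≤-reflexive j≡) (+-monoˡ-≤ j′ ∣X∣≤k)))
    j′<j : j′ < j
    j′<j = ≤-trans (+-monoˡ-≤ j′ (nonempty⇒∣p∣≥1 X neX)) (≤-reflexive (sym j≡))

  starLower : ∀ f U j → InStar U → c ∈ U → ∣ U ∣ ≡ suc j → suc j ≤ f → starValue j ≤ gameValue G f U
  starLower (suc f) U j U-star c∈U ∣U∣≡ (s≤s j≤f) = listerBound G f U M (starValue j) M⊆U (c , c∈M) answers
    where
    open StarMark (starMark U j U-star c∈U ∣U∣≡ (triRoot j) (triRoot≤ j))
    answers : ∀ X → Response G M X → starValue j ≤ ∣ M ∣ + gameValue G f (U ─ X)
    answers X (X⊆M , neX , indX) with c ∈? X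
    ... | yes c∈X = begin
      suc (j + triRoot j)            ≡⟨ cong suc (+-comm j (triRoot j)) ⟩
      suc (triRoot j) + j            ≤⟨ +-mono-≤ size (centreColoured f U j X ∣U∣≡ j≤f (M⊆U ∘ X⊆M)
                                          (centreAlone X⊆M indX c∈X) neX) ⟩
      ∣ M ∣ + gameValue G f (U ─ X)  ∎
      where open ≤-Reasoning
    ... | no c∉X =
      let j′ , ∣U─X∣≡ , j∸k≤j′ , j′<j = leavesColoured U j X ∣U∣≡ (M⊆U ∘ X⊆M) neX (fewLeaves X⊆M c∉X) in
      ≤-trans (starValue-step j j′ j∸k≤j′)
        (+-mono-≤ size (starLower f (U ─ X) j′ (U-star ∘ p─q⊆p U X) (x∈p∧x∉q⇒x∈p─q c∈U c∉X)
          ∣U─X∣≡ (≤-trans j′<j j≤f)))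

-- The vertices are split into the rest
-- H, the leaves L of c, and c itself; leaves are adjacent only to c, and
-- the only neighbour of c in H is w.  On a covered set U Painter answers in
-- H optimally and in the star part greedily, which gives
--   value(U) ≤ value(U ∩ H) + starPart U.
module StemUpper (G : Graph) (c w : Fin (n G)) (H L : Subset (n G))
  (c∉H : c ∉ H) (c∉L : c ∉ L)
  (leaf : ∀ {x z} → x ∈ L → adj G x z ≡ true → z ≡ c)
  (stem : ∀ {z} → z ∈ H → adj G c z ≡ true → z ≡ w) where

  private
    g : ℕ → Subset (n G) → ℕ
    g = gameValue G

  Covered : Subset (n G) → Set
  Covered U = ∀ {x} → x ∈ U → x ∈ H ⊎ x ∈ L ⊎ x ≡ c

  starPart : Subset (n G) → ℕ
  starPart V = starCost (member c V) (member w (V ∩ H)) ∣ V ∩ L ∣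

  covered-size : ∀ M → Covered M → ∣ M ∣ ≤ ∣ M ∩ H ∣ + (∣ M ∩ ⁅ c ⁆ ∣ + ∣ M ∩ L ∣)
  covered-size M cov = begin
    ∣ M ∣                                             ≡⟨ ∣p∣≡∣p∩q∣+∣p─q∣ M H ⟩
    ∣ M ∩ H ∣ + ∣ M ─ H ∣                             ≡⟨ cong (∣ M ∩ H ∣ +_) (∣p∣≡∣p∩q∣+∣p─q∣ (M ─ H) L) ⟩
    ∣ M ∩ H ∣ + (∣ (M ─ H) ∩ L ∣ + ∣ (M ─ H) ─ L ∣)  ≤⟨ +-monoʳ-≤ ∣ M ∩ H ∣ (+-mono-≤
                                                         (p⊆q⇒∣p∣≤∣q∣ leaves) (p⊆q⇒∣p∣≤∣q∣ centre)) ⟩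
    ∣ M ∩ H ∣ + (∣ M ∩ L ∣ + ∣ M ∩ ⁅ c ⁆ ∣)          ≡⟨ cong (∣ M ∩ H ∣ +_) (+-comm ∣ M ∩ L ∣ ∣ M ∩ ⁅ c ⁆ ∣) ⟩
    ∣ M ∩ H ∣ + (∣ M ∩ ⁅ c ⁆ ∣ + ∣ M ∩ L ∣)          ∎
    where
    open ≤-Reasoning
    leaves : (M ─ H) ∩ L ⊆ M ∩ L
    leaves x∈ = let x∈M─H , x∈L = x∈p∩q⁻ (M ─ H) L x∈ in x∈p∩q⁺ (p─q⊆p M H x∈M─H , x∈L)
    centre : (M ─ H) ─ L ⊆ M ∩ ⁅ c ⁆
    centre {x} x∈ with x∈p─q⁻ (M ─ H) L x∈
    ... | x∈M─H , x∉L with x∈p─q⁻ M H x∈M─H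
    ...   | x∈M , x∉H with cov x∈M
    ...     | inj₁ x∈H        = ⊥-elim (x∉H x∈H)
    ...     | inj₂ (inj₁ x∈L) = ⊥-elim (x∉L x∈L)
    ...     | inj₂ (inj₂ refl) = x∈p∩q⁺ (x∈M , x∈⁅x⁆ c)

  -- Painter's answer to a marked set N ⊆ U ∩ H in the game on U ∩ H, allowed
  -- to be empty when N is.
  record RestAnswer (f : ℕ) (U N : Subset (n G)) : Set where
    field
      XH          : Subset (n G)
      XH⊆N        : XH ⊆ N
      independent : Independent G XH
      nonempty    : Nonempty N → Nonempty XH
      cost        : ∣ N ∣ + g f ((U ∩ H) ─ XH) ≤ g (suc f) (U ∩ H)

  restAnswer : ∀ f U N → N ⊆ U ∩ H → RestAnswer f U N
  restAnswer f U N N⊆ with nonempty? N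
  ... | yes ne = let XH , (XH⊆N , neXH , indXH) , cost = optimalResponse G f (U ∩ H) N N⊆ ne in
                 record { XH = XH ; XH⊆N = XH⊆N ; independent = indXH ; nonempty = λ _ → neXH ; cost = cost }
  ... | no empty = record
    { XH = ⊥ ; XH⊆N = ⊥⊆ ; independent = λ u∈⊥ _ → ⊥-elim (∉⊥ u∈⊥)
    ; nonempty = λ ne → ⊥-elim (empty ne) ; cost = nothingMarked }
    where
    nothingMarked : ∣ N ∣ + g f ((U ∩ H) ─ ⊥) ≤ g (suc f) (U ∩ H)
    nothingMarked rewrite Empty-unique empty | ∣⊥∣≡0 (n G) | p─⊥≡p (U ∩ H) = fuel-step G f (U ∩ H)

  InStarPart : Subset (n G) → Set
  InStarPart XS = ∀ {x} → x ∈ XS → x ∈ L ⊎ x ≡ c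

  private
    interchange : ∀ a b d e → (a + b) + (d + e) ≡ (a + d) + (b + e)
    interchange = solve-∀

  module Round (f : ℕ) (IH : ∀ V → Covered V → g f V ≤ g f (V ∩ H) + starPart V)
               (U M : Subset (n G)) (covU : Covered U) (M⊆U : M ⊆ U) where

    SplitAnswer : Subset (n G) → Subset (n G) → Set
    SplitAnswer XH XS = Response G M (XH ∪ XS) ×
      ∣ M ∣ + g f (U ─ (XH ∪ XS)) ≤
        (∣ M ∩ H ∣ + g f ((U ∩ H) ─ XH)) + ((∣ M ∩ ⁅ c ⁆ ∣ + ∣ M ∩ L ∣) + starPart (U ─ (XH ∪ XS)))

    combine : ∀ XH XS → XH ⊆ M ∩ H → Independent G XH → XS ⊆ M → InStarPart XS → Independent G XS →
      (c ∈ XS → w ∉ XH) → Nonempty XH ⊎ Nonempty XS → SplitAnswer XH XS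
    combine XH XS XH⊆ indH XS⊆M XS-star indS c∈XS⇒w∉XH ne = (X⊆M , neX ne , indX) , cost
      where
      X : Subset (n G)
      X = XH ∪ XS
      XH⊆H : XH ⊆ H
      XH⊆H = proj₂ ∘ x∈p∩q⁻ M H ∘ XH⊆
      X⊆M : X ⊆ M
      X⊆M x∈ with x∈p∪q⁻ XH XS x∈
      ... | inj₁ x∈XH = proj₁ (x∈p∩q⁻ M H (XH⊆ x∈XH))
      ... | inj₂ x∈XS = XS⊆M x∈XS
      neX : Nonempty XH ⊎ Nonempty XS → Nonempty X
      neX (inj₁ (x , x∈)) = x , x∈p∪q⁺ (inj₁ x∈)
      neX (inj₂ (x , x∈)) = x , x∈p∪q⁺ (inj₂ x∈)
      -- a leaf sees only c ∉ H, and c sees only w in H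
      cross : ∀ {s h} → s ∈ XS → h ∈ XH → adj G s h ≡ false
      cross {s} {h} s∈ h∈ with adj G s h in edge | XS-star s∈
      ... | false | _           = refl
      ... | true  | inj₁ s∈L   = ⊥-elim (c∉H (subst (_∈ H) (leaf s∈L edge) (XH⊆H h∈)))
      ... | true  | inj₂ refl  = ⊥-elim (c∈XS⇒w∉XH s∈ (subst (_∈ XH) (stem (XH⊆H h∈) edge) h∈))
      indX : Independent G X
      indX u∈ v∈ with x∈p∪q⁻ XH XS u∈ | x∈p∪q⁻ XH XS v∈
      ... | inj₁ u∈H | inj₁ v∈H = indH u∈H v∈H
      ... | inj₂ u∈S | inj₂ v∈S = indS u∈S v∈S
      ... | inj₂ u∈S | inj₁ v∈H = cross u∈S v∈H
      ... | inj₁ u∈H | inj₂ v∈S = trans (Graph.sym G _ _) (cross v∈S u∈H)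
      restShrinks : (U ─ X) ∩ H ⊆ (U ∩ H) ─ XH
      restShrinks x∈ = let x∈U─X , x∈H = x∈p∩q⁻ (U ─ X) H x∈ ; x∈U , x∉X = x∈p─q⁻ U X x∈U─X in
        x∈p∧x∉q⇒x∈p─q (x∈p∩q⁺ (x∈U , x∈H)) (x∉X ∘ x∈p∪q⁺ ∘ inj₁)
      cost : ∣ M ∣ + g f (U ─ X) ≤
        (∣ M ∩ H ∣ + g f ((U ∩ H) ─ XH)) + ((∣ M ∩ ⁅ c ⁆ ∣ + ∣ M ∩ L ∣) + starPart (U ─ X))
      cost = begin
        ∣ M ∣ + g f (U ─ X)                                    ≤⟨ +-monoʳ-≤ ∣ M ∣ (IH (U ─ X) (covU ∘ p─q⊆p U X)) ⟩
        ∣ M ∣ + (g f ((U ─ X) ∩ H) + starPart (U ─ X))         ≤⟨ +-mono-≤ (covered-size M (covU ∘ M⊆U))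
                                                                   (+-monoˡ-≤ _ (gameValue-mono G f _ _ restShrinks)) ⟩
        (∣ M ∩ H ∣ + (∣ M ∩ ⁅ c ⁆ ∣ + ∣ M ∩ L ∣)) + (g f ((U ∩ H) ─ XH) + starPart (U ─ X))
                                                               ≡⟨ interchange ∣ M ∩ H ∣ _ (g f ((U ∩ H) ─ XH)) (starPart (U ─ X)) ⟩
        (∣ M ∩ H ∣ + g f ((U ∩ H) ─ XH)) + ((∣ M ∩ ⁅ c ⁆ ∣ + ∣ M ∩ L ∣) + starPart (U ─ X)) ∎
        where open ≤-Reasoning

    A : ℕ
    A = g (suc f) (U ∩ H)

    Answer : Set
    Answer = ∃ λ X → Response G M X × ∣ M ∣ + g f (U ─ X) ≤ A + starPart U

    settle : ∀ {X h s} e → Response G M X × ∣ M ∣ + g f (U ─ X) ≤ h + s → h ≤ A + e →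
      e + s ≤ starPart U → Answer
    settle {X} {h} {s} e (resp , cost) h≤ star≤ = X , resp , (begin
      ∣ M ∣ + g f (U ─ X) ≤⟨ cost ⟩
      h + s               ≤⟨ +-monoˡ-≤ s h≤ ⟩
      A + e + s           ≡⟨ +-assoc A e s ⟩
      A + (e + s)         ≤⟨ +-monoʳ-≤ A star≤ ⟩
      A + starPart U      ∎)
      where open ≤-Reasoning

    ℓ j : ℕ
    ℓ = ∣ M ∩ L ∣
    j = ∣ U ∩ L ∣
    wU : Bool
    wU = member w (U ∩ H)

    M∩H⊆U∩H : M ∩ H ⊆ U ∩ H
    M∩H⊆U∩H x∈ = let x∈M , x∈H = x∈p∩q⁻ M H x∈ in x∈p∩q⁺ (M⊆U x∈M , x∈H)

    open RestAnswer (restAnswer f U (M ∩ H) M∩H⊆U∩H)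
      renaming (XH to XH₀; XH⊆N to XH₀⊆; independent to indXH₀; nonempty to neXH₀; cost to costH)

    costH₀ : ∣ M ∩ H ∣ + g f ((U ∩ H) ─ XH₀) ≤ A + 0
    costH₀ = subst (∣ M ∩ H ∣ + g f ((U ∩ H) ─ XH₀) ≤_) (sym (+-identityʳ A)) costH

    M∩L-star : InStarPart (M ∩ L)
    M∩L-star = inj₁ ∘ proj₂ ∘ x∈p∩q⁻ M L
    indM∩L : Independent G (M ∩ L)
    indM∩L {u} {v} u∈ v∈ with adj G u v in edge
    ... | false = refl
    ... | true  = ⊥-elim (c∉L (subst (_∈ L) (leaf (proj₂ (x∈p∩q⁻ M L u∈)) edge) (proj₂ (x∈p∩q⁻ M L v∈))))
    c∉M∩L : c ∉ M ∩ L
    c∉M∩L = c∉L ∘ proj₂ ∘ x∈p∩q⁻ M L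

    leavesPlay : Nonempty XH₀ ⊎ Nonempty (M ∩ L) → SplitAnswer XH₀ (M ∩ L)
    leavesPlay = combine XH₀ (M ∩ L) XH₀⊆ indXH₀ (proj₁ ∘ x∈p∩q⁻ M L) M∩L-star indM∩L (⊥-elim ∘ c∉M∩L)

    Xₗ : Subset (n G)
    Xₗ = XH₀ ∪ (M ∩ L)

    remaining-≤ : ∀ X → ∣ (U ─ X) ∩ L ∣ ≤ j
    remaining-≤ X = p⊆q⇒∣p∣≤∣q∣ (λ x∈ → let x∈U─X , x∈L = x∈p∩q⁻ (U ─ X) L x∈ in
      x∈p∩q⁺ (p─q⊆p U X x∈U─X , x∈L))

    remainingₗ : ℓ + ∣ (U ─ Xₗ) ∩ L ∣ ≤ j
    remainingₗ = disjoint-size (M ∩ L) ((U ─ Xₗ) ∩ L) (U ∩ L)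
      (λ x∈ → let x∈M , x∈L = x∈p∩q⁻ M L x∈ in x∈p∩q⁺ (M⊆U x∈M , x∈L))
      (λ x∈ → let x∈U─X , x∈L = x∈p∩q⁻ (U ─ Xₗ) L x∈ in x∈p∩q⁺ (p─q⊆p U Xₗ x∈U─X , x∈L))
      (λ x∈M∩L x∈ → x∈p─q⇒x∉q U Xₗ (proj₁ (x∈p∩q⁻ (U ─ Xₗ) L x∈)) (x∈p∪q⁺ (inj₂ x∈M∩L)))

    w-flag≤ : ∀ X → member w ((U ─ X) ∩ H) ≤ᵇ wU
    w-flag≤ X = member-mono w (λ x∈ → let x∈U─X , x∈H = x∈p∩q⁻ (U ─ X) H x∈ in x∈p∩q⁺ (p─q⊆p U X x∈U─X , x∈H))

    c∉Xₗ : c ∉ Xₗ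
    c∉Xₗ c∈ with x∈p∪q⁻ XH₀ (M ∩ L) c∈
    ... | inj₁ c∈XH₀ = c∉H (proj₂ (x∈p∩q⁻ M H (XH₀⊆ c∈XH₀)))
    ... | inj₂ c∈M∩L = c∉M∩L c∈M∩L

    answerNoCentre : c ∉ M → Nonempty M → Answer
    answerNoCentre c∉M (x , x∈M) = settle 0 (leavesPlay somethingColoured) costH₀ star
      where
      somethingColoured : Nonempty XH₀ ⊎ Nonempty (M ∩ L)
      somethingColoured with covU (M⊆U x∈M)
      ... | inj₁ x∈H         = inj₁ (neXH₀ (x , x∈p∩q⁺ (x∈M , x∈H)))
      ... | inj₂ (inj₁ x∈L)  = inj₂ (x , x∈p∩q⁺ (x∈M , x∈L))
      ... | inj₂ (inj₂ refl) = ⊥-elim (c∉M x∈M)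
      star : 0 + ((∣ M ∩ ⁅ c ⁆ ∣ + ℓ) + starPart (U ─ Xₗ)) ≤ starPart U
      star rewrite ∣p∩⁅x⁆∣≡0 M c∉M = ≤-trans
        (absorbLeaves ℓ ∣ (U ─ Xₗ) ∩ L ∣ (member-mono c (p─q⊆p U Xₗ)) (w-flag≤ Xₗ))
        (starCost-monoʳ (member c U) wU remainingₗ)

    module WithCentre (c∈M : c ∈ M) where

      c-flag : member c U ≡ true
      c-flag = ∈⇒member (M⊆U c∈M)

      w-flag : w ∈ XH₀ → wU ≡ true
      w-flag w∈ = ∈⇒member (M∩H⊆U∩H (XH₀⊆ w∈))

      centreStays : member c (U ─ Xₗ) ≡ true
      centreStays = ∈⇒member (x∈p∧x∉q⇒x∈p─q (M⊆U c∈M) c∉Xₗ)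

      wColoured : w ∈ XH₀ → member w ((U ─ Xₗ) ∩ H) ≡ false
      wColoured w∈ = ∉⇒member λ w∈′ →
        x∈p─q⇒x∉q U Xₗ (proj₁ (x∈p∩q⁻ (U ─ Xₗ) H w∈′)) (x∈p∪q⁺ (inj₁ w∈))

      centrePlay : ∀ XH → XH ⊆ M ∩ H → Independent G XH → w ∉ XH → SplitAnswer XH ⁅ c ⁆
      centrePlay XH XH⊆ indXH w∉XH = combine XH ⁅ c ⁆ XH⊆ indXH (x∈p⇒⁅x⁆⊆p c∈M)
        (inj₂ ∘ x∈⁅y⁆⇒x≡y c) (proj₂ (proj₂ (singletonResponse G c∈M))) (λ _ → w∉XH) (inj₂ (c , x∈⁅x⁆ c))

      centreGone : ∀ XH → member c (U ─ (XH ∪ ⁅ c ⁆)) ≡ false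
      centreGone XH = ∉⇒member λ c∈ → x∈p─q⇒x∉q U (XH ∪ ⁅ c ⁆) c∈ (x∈p∪q⁺ (inj₂ (x∈⁅x⁆ c)))

      answerBeyondQuota : leafQuota wU j < ℓ → Answer
      answerBeyondQuota beyond =
        settle 0 (leavesPlay (inj₂ (∣p∣≥1⇒nonempty (M ∩ L) (≤-trans (s≤s z≤n) beyond)))) costH₀ star
        where
        j′ : ℕ
        j′ = ∣ (U ─ Xₗ) ∩ L ∣
        star : 0 + ((∣ M ∩ ⁅ c ⁆ ∣ + ℓ) + starCost (member c (U ─ Xₗ)) (member w ((U ─ Xₗ) ∩ H)) j′)
               ≤ starCost (member c U) wU j
        star rewrite ∣p∩⁅x⁆∣≡1 M c∈M | c-flag | centreStays = ≤-trans
          (leavesBeyondQuota ℓ j′ (w-flag≤ Xₗ) (≤-<-trans (leafQuota-mono {wU} b≤b remainingₗ) beyond))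
          (starCost-monoʳ true wU remainingₗ)

      answerCentre : ℓ ≤ leafQuota wU j → w ∉ XH₀ → Answer
      answerCentre within w∉ = settle 0 (centrePlay XH₀ XH₀⊆ indXH₀ w∉) costH₀ star
        where
        X : Subset (n G)
        X = XH₀ ∪ ⁅ c ⁆
        star : 0 + ((∣ M ∩ ⁅ c ⁆ ∣ + ℓ) + starCost (member c (U ─ X)) (member w ((U ─ X) ∩ H)) ∣ (U ─ X) ∩ L ∣)
               ≤ starCost (member c U) wU j
        star rewrite ∣p∩⁅x⁆∣≡1 M c∈M | c-flag | centreGone XH₀ =
          ≤-trans (+-monoʳ-≤ (suc ℓ) (remaining-≤ X)) (centreWithinQuota wU ℓ j within)

      -- XH₀ colours w but there is room for one more leaf: colour the centre
      -- and answer in H without w, overspending by one there.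
      answerSparingW : w ∈ XH₀ → suc ℓ ≤ triRoot (suc j) → Answer
      answerSparingW w∈ room = settle 1 (centrePlay XH₁ XH₁⊆ indXH₁ w∉XH₁) costH₁ star
        where
        N : Subset (n G)
        N = (M ∩ H) ─ ⁅ w ⁆
        w∈M∩H : w ∈ M ∩ H
        w∈M∩H = XH₀⊆ w∈
        open RestAnswer (restAnswer f U N (M∩H⊆U∩H ∘ p─q⊆p (M ∩ H) ⁅ w ⁆))
          renaming (XH to XH₁; independent to indXH₁; cost to costN)
        XH₁⊆ : XH₁ ⊆ M ∩ H
        XH₁⊆ = p─q⊆p (M ∩ H) ⁅ w ⁆ ∘ XH⊆N
        w∉XH₁ : w ∉ XH₁
        w∉XH₁ w∈XH₁ = x∈p─q⇒x∉q (M ∩ H) ⁅ w ⁆ (XH⊆N w∈XH₁) (x∈⁅x⁆ w)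
        costH₁ : ∣ M ∩ H ∣ + g f ((U ∩ H) ─ XH₁) ≤ A + 1
        costH₁ = begin
          ∣ M ∩ H ∣ + g f ((U ∩ H) ─ XH₁)           ≡⟨ cong (_+ g f ((U ∩ H) ─ XH₁)) (trans
                                                        (∣p∣≡∣q∣+∣p─q∣ (M ∩ H) ⁅ w ⁆ (x∈p⇒⁅x⁆⊆p w∈M∩H))
                                                        (cong (_+ ∣ N ∣) (∣⁅x⁆∣≡1 w))) ⟩
          1 + ∣ N ∣ + g f ((U ∩ H) ─ XH₁)           ≡⟨ +-assoc 1 ∣ N ∣ _ ⟩
          1 + (∣ N ∣ + g f ((U ∩ H) ─ XH₁))         ≤⟨ s≤s costN ⟩
          1 + A                                     ≡⟨ +-comm 1 A ⟩
          A + 1                                     ∎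
          where open ≤-Reasoning
        X : Subset (n G)
        X = XH₁ ∪ ⁅ c ⁆
        star : 1 + ((∣ M ∩ ⁅ c ⁆ ∣ + ℓ) + starCost (member c (U ─ X)) (member w ((U ─ X) ∩ H)) ∣ (U ─ X) ∩ L ∣)
               ≤ starCost (member c U) wU j
        star rewrite ∣p∩⁅x⁆∣≡1 M c∈M | c-flag | w-flag w∈ | centreGone XH₁ =
          ≤-trans (s≤s (+-monoʳ-≤ (suc ℓ) (remaining-≤ X))) (centreSparingW ℓ j room)

      answerLeavesWithW : w ∈ XH₀ → triRoot (suc j) ≤ ℓ → Answer
      answerLeavesWithW w∈ full = settle 0 (leavesPlay (inj₁ (w , w∈))) costH₀ star
        where
        j′ : ℕ
        j′ = ∣ (U ─ Xₗ) ∩ L ∣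
        star : 0 + ((∣ M ∩ ⁅ c ⁆ ∣ + ℓ) + starCost (member c (U ─ Xₗ)) (member w ((U ─ Xₗ) ∩ H)) j′)
               ≤ starCost (member c U) wU j
        star rewrite ∣p∩⁅x⁆∣≡1 M c∈M | c-flag | w-flag w∈ | centreStays | wColoured w∈ = ≤-trans
          (leavesAtQuota ℓ j′ (≤-trans (triRoot-mono (s≤s remainingₗ)) full))
          (starCost-monoʳ true true remainingₗ)

    open WithCentre

    answer : Nonempty M → Answer
    answer ne with c ∈? M
    ... | no c∉M = answerNoCentre c∉M ne
    ... | yes c∈M with ℓ ≤? leafQuota wU j
    ...   | no beyond = answerBeyondQuota c∈M (≰⇒> beyond)
    ...   | yes within with w ∈? XH₀
    ...     | no w∉ = answerCentre c∈M within w∉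
    ...     | yes w∈ with suc ℓ ≤? triRoot (suc j)
    ...       | yes room = answerSparingW c∈M w∈ room
    ...       | no full  = answerLeavesWithW c∈M w∈ (≤-pred (≰⇒> full))

  stemUpper : ∀ f U → Covered U → g f U ≤ g f (U ∩ H) + starPart U
  stemUpper zero    U covU = z≤n
  stemUpper (suc f) U covU = painterBound G f U _ λ M M⊆U ne →
    Round.answer f (stemUpper f) U M covU M⊆U ne

module _ (r : ℕ) where

  private
    leavesK : Subset (suc r)
    leavesK = outside ∷ ⊤

    centre∉leaves : zero ∉ leavesK
    centre∉leaves ()

    centre~leaves : ∀ {x} → x ∈ leavesK → adj (K1 r) zero x ≡ true
    centre~leaves {suc x} _ = refl

    leafK : ∀ {x z} → x ∈ leavesK → adj (K1 r) x z ≡ true → z ≡ zero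
    leafK {suc x} {zero} _ _ = refl

    open StemUpper (K1 r) zero zero ⊥ leavesK ∉⊥ centre∉leaves leafK (⊥-elim ∘ ∉⊥)
    open StarLower (K1 r) zero leavesK centre~leaves

    coveredK : Covered ⊤
    coveredK {zero}  _ = inj₂ (inj₂ refl)
    coveredK {suc x} _ = inj₂ (inj₁ (there ∈⊤))

    inStarK : InStar ⊤
    inStarK {zero}  _ = inj₂ refl
    inStarK {suc x} _ = inj₁ (there ∈⊤)

  starK-value : sumColorCost (K1 r) ≡ starValue r
  starK-value = ≤-antisym upper lower
    where
    upper : sumColorCost (K1 r) ≤ starValue r
    upper = subst (sumColorCost (K1 r) ≤_) noRest (stemUpper (suc r) ⊤ coveredK)
      where
      noRest : gameValue (K1 r) (suc r) (⊤ ∩ ⊥) + starPart ⊤ ≡ starValue r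
      noRest = cong₂ _+_ (trans (cong (gameValue (K1 r) (suc r)) (∩-identityˡ ⊥)) (gameValue-⊥ (K1 r) (suc r)))
                         (cong starValue (trans (cong ∣_∣ (∩-identityˡ leavesK)) (∣⊤∣≡n r)))
    lower : starValue r ≤ sumColorCost (K1 r)
    lower = starLower (suc r) ⊤ r inStarK here (∣⊤∣≡n (suc r)) ≤-refl

-- A leaf has only one neighbour: two distinct neighbours would be counted
-- twice by `degree`.
length≥2 : ∀ {A : Set} {a b : A} (xs : List A) → a ≢ b → a ∈ˡ xs → b ∈ˡ xs → 2 ≤ length xs
length≥2 (y ∷ ys) a≢b (here refl) (here refl) = ⊥-elim (a≢b refl)
length≥2 (y ∷ ys) a≢b (here refl) (there b∈) = s≤s (∈-length b∈)
length≥2 (y ∷ ys) a≢b (there a∈) (here refl) = s≤s (∈-length a∈)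
length≥2 (y ∷ ys) a≢b (there a∈) (there b∈) = m≤n⇒m≤1+n (length≥2 ys a≢b a∈ b∈)

leaf-unique-neighbour : ∀ G {x a b} → isLeaf G x ≡ true → adj G x a ≡ true → adj G x b ≡ true → a ≡ b
leaf-unique-neighbour G {x} {a} {b} isLeaf x~a x~b with degree G x ≟ 1 | a ≟ᶠ b
... | yes deg≡1 | no a≢b = ⊥-elim (1+n≰n (≤-trans (length≥2 _ a≢b (neighbour x~a) (neighbour x~b)) (≤-reflexive deg≡1)))
  where
  neighbour : ∀ {z} → adj G x z ≡ true → z ∈ˡ filter (λ z → adj G x z ≟ᵇ true) (allFin (n G))
  neighbour x~z = ∈-filter⁺ (λ z → adj G x z ≟ᵇ true) (∈-allFin _) x~z
... | _ | yes a≡b = a≡b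

module StemOf (T : Graph) (v : Fin (n T)) (fewNonLeaves : ∣ nonLeafNbrs T v ∣ ≤ 1) where

  R H NL : Subset (n T)
  R  = leafNbrs T v
  H  = removeStemLeaves T v
  NL = nonLeafNbrs T v

  R-adj : ∀ {x} → x ∈ R → adj T v x ≡ true
  R-adj {x} x∈R = ∧-conicalˡ _ _ (trans (sym (lookup∘tabulate _ x)) (∈⇒member x∈R))

  R-leaf : ∀ {x} → x ∈ R → isLeaf T x ≡ true
  R-leaf {x} x∈R = ∧-conicalʳ (adj T v x) _ (trans (sym (lookup∘tabulate _ x)) (∈⇒member x∈R))

  v∉R : v ∉ R
  v∉R v∈R with trans (sym (R-adj v∈R)) (irrefl T v)
  ... | ()

  v∉H : v ∉ H
  v∉H v∈H = x∈p─q⇒x∉q (⊤ ─ R) ⁅ v ⁆ v∈H (x∈⁅x⁆ v)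

  H∩R=∅ : Disjoint H R
  H∩R=∅ x∈H = x∈p─q⇒x∉q ⊤ R (p─q⊆p (⊤ ─ R) ⁅ v ⁆ x∈H)

  leafOnlyToV : ∀ {x z} → x ∈ R → adj T x z ≡ true → z ≡ v
  leafOnlyToV x∈R x~z = leaf-unique-neighbour T (R-leaf x∈R) x~z (trans (Graph.sym T _ v) (R-adj x∈R))

  H-neighbour : ∀ {z} → z ∈ H → adj T v z ≡ true → z ∈ NL
  H-neighbour {z} z∈H v~z with isLeaf T z in leafz
  ... | true  = ⊥-elim (H∩R=∅ z∈H (member⇒∈ (trans (lookup∘tabulate _ z) (cong₂ _∧_ v~z leafz))))
  ... | false = member⇒∈ (trans (lookup∘tabulate _ z) (cong₂ (λ a b → a ∧ not b) v~z leafz))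

  uniqueNonLeaf : ∃ λ w → ∀ {z} → z ∈ NL → z ≡ w
  uniqueNonLeaf with nonempty? NL
  ... | no  none     = v , λ z∈ → ⊥-elim (none (_ , z∈))
  ... | yes (w , w∈) = w , onlyW
    where
    onlyW : ∀ {z} → z ∈ NL → z ≡ w
    onlyW {z} z∈ with z ≟ᶠ w
    ... | yes z≡w = z≡w
    ... | no  z≢w = ⊥-elim (1+n≰n (≤-trans (∣p∣≥2 NL z≢w z∈ w∈) fewNonLeaves))

  w : Fin (n T)
  w = proj₁ uniqueNonLeaf

  open StemUpper T v w H R v∉H v∉R leafOnlyToV (λ z∈H v~z → proj₂ uniqueNonLeaf (H-neighbour z∈H v~z))
    public
  open StarLower T v R R-adj public

  covered : Covered ⊤
  covered {x} _ with x ∈? R | x ≟ᶠ v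
  ... | yes x∈R | _        = inj₂ (inj₁ x∈R)
  ... | no  _   | yes refl = inj₂ (inj₂ refl)
  ... | no  x∉R | no  x≢v  = inj₁ (x∈p∧x∉q⇒x∈p─q (x∈p∧x∉q⇒x∈p─q ∈⊤ x∉R) (x≢v ∘ x∈⁅y⁆⇒x≡y v))

  S : Subset (n T)
  S = R ∪ ⁅ v ⁆

  S-star : InStar S
  S-star x∈S = [ inj₁ , inj₂ ∘ x∈⁅y⁆⇒x≡y v ]′ (x∈p∪q⁻ R ⁅ v ⁆ x∈S)

  H∩S=∅ : Disjoint H S
  H∩S=∅ x∈H x∈S = [ H∩R=∅ x∈H , (λ x∈v → v∉H (subst (_∈ H) (x∈⁅y⁆⇒x≡y v x∈v) x∈H)) ]′ (x∈p∪q⁻ R ⁅ v ⁆ x∈S)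

  starPart-⊤ : starCost (member v ⊤) (member w (⊤ ∩ H)) ∣ ⊤ ∩ R ∣ ≡ starCost true (member w H) ∣ R ∣
  starPart-⊤ rewrite ∈⇒member (∈⊤ {x = v}) | ∩-identityˡ H | ∩-identityˡ R = refl

  S-size : ∣ S ∣ ≡ suc ∣ R ∣
  S-size = ∣p∪⁅x⁆∣≡1+∣p∣ R v∉R

-- Lemma 3.1.  Painter's strategy splitting the game at the stem gives "≤",
-- Lister playing on H and on the star separately gives "≥".
lemma3p1 : (T : Graph) → Forest T → (v : Fin (n T)) → IsStem T v →
    1 ≤ ∣ leafNbrs T v ∣ → ¬ Triangular (suc ∣ leafNbrs T v ∣) →
    sumColorCost T ≡ inducedCost T (removeStemLeaves T v) + sumColorCost (K1 ∣ leafNbrs T v ∣)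
lemma3p1 T _ v (_ , fewNonLeaves) _ ¬tri =
  trans (≤-antisym upper lower) (cong (inducedCost T H +_) (sym (starK-value r)))
  where
  open StemOf T v fewNonLeaves
  N r : ℕ
  N = n T
  r = ∣ R ∣
  g : ℕ → Subset N → ℕ
  g = gameValue T
  open ≤-Reasoning
  upper : sumColorCost T ≤ inducedCost T H + starValue r
  upper = begin
    g N ⊤                                 ≤⟨ stemUpper N ⊤ covered ⟩
    g N (⊤ ∩ H) + starPart ⊤              ≡⟨ cong₂ _+_ (cong (g N) (∩-identityˡ H)) starPart-⊤ ⟩
    g N H + starCost true (member w H) r  ≤⟨ +-monoʳ-≤ (g N H) (starCost-nonTriangular r ¬tri (member w H)) ⟩
    g N H + starValue r                   ∎
  lower : inducedCost T H + starValue r ≤ sumColorCost T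
  lower = begin
    g N H + starValue r  ≤⟨ +-monoʳ-≤ (g N H) (starLower N S r S-star (x∈p∪q⁺ (inj₂ (x∈⁅x⁆ v))) S-size
                              (subst (_≤ N) S-size (∣p∣≤n S))) ⟩
    g N H + g N S        ≤⟨ superadditive T N N H S ⊤ ⊆⊤ ⊆⊤ H∩S=∅ ⟩
    g (N + N) ⊤          ≤⟨ fuel-enough* T N N ⊤ (≤-reflexive (∣⊤∣≡n N)) ⟩
    g N ⊤                ∎
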